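{- Let $G$ be a graph and $A,B\subseteq V(G)$ with $A\cap B=\emptyset$. Let $G'$ be the graph obtained from $G$ by applying the subdivided bipartite complement between $A$ and $B$, and let $R$ be the set of vertices created in this construction. Then for each $C\in\{A,B\}$, $\mathrm{cutmim}_{G'}(C,R)\le 2$.
   Context: The bipartite complement between disjoint vertex sets $A$ and $B$ in a graph replaces the edges between $A$ and $B$ by exactly the non-edges between $A$ and $B$ (pairs $ab$, $a\in A$, $b\in B$, that were not edges). The subdivided bipartite complement between disjoint $A,B\subseteq V(G)$ is: (1) subdivide each edge $uv$ of $G$ with $u\in A$, $v\in B$ by a new vertex; let $R$ be the set of these new vertices; (2) take the bipartite complement between $A$ and $R$ and the bipartite complement between $B$ and $R$. For disjoint $C,D\subseteq V(G')$, $\mathrm{cutmim}_{G'}(C,D)$ is the maximum size of an induced matching in the bipartite graph on $C\cup D$ consisting of the edges of $G'$ between $C$ and $D$. -}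

module Defs where

open import Data.Nat using (ℕ; _≤_)
open import Data.Fin using (Fin)
open import Data.Fin.Properties using (_≟_)
open import Data.Bool using (Bool; true; false; not; _∧_; _∨_; if_then_else_)
open import Data.Sum using (_⊎_; inj₁; inj₂)
open import Data.Product using (Σ; _×_; _,_; proj₁; proj₂)
open import Relation.Binary.PropositionalEquality using (_≡_)
open import Relation.Nullary using (¬_)
open import Relation.Nullary.Decidable using (⌊_⌋)
open import Function.Definitions using (Injective)

record Graph (n : ℕ) : Set where
  field
    adj    : Fin n → Fin n → Bool
    sym    : ∀ u v → adj u v ≡ adj v u
    irrefl : ∀ v → adj v v ≡ false
open Graph public

VSet : Set → Set
VSet W = W → Bool

Disjoint : {W : Set} → VSet W → VSet W → Set
Disjoint {W} X Y = ∀ w → X w ≡ true → Y w ≡ true → ⊥'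
  where open import Data.Empty renaming (⊥ to ⊥')

Adj : Set → Set
Adj W = W → W → Bool

bipComp : {W : Set} → Adj W → VSet W → VSet W → Adj W
bipComp adj' X Y u v =
  if (X u ∧ Y v) ∨ (Y u ∧ X v) then not (adj' u v) else adj' u v

module _ {n : ℕ} (G : Graph n) (A B : VSet (Fin n)) where

  _==_ : Fin n → Fin n → Bool
  x == y = ⌊ x ≟ y ⌋

  -- Edges uv of G with u ∈ A, v ∈ B (each such edge once, as A ∩ B = ∅); these get subdivided.
  SubEdge : Set
  SubEdge = Σ (Fin n × Fin n) λ p →
    (A (proj₁ p) ≡ true) × (B (proj₂ p) ≡ true) × (adj G (proj₁ p) (proj₂ p) ≡ true)

  SVert : Set
  SVert = Fin n ⊎ SubEdge

  crossAB : Fin n → Fin n → Bool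
  crossAB u v = (A u ∧ B v) ∨ (B u ∧ A v)

  subdivAdj : Adj SVert
  subdivAdj (inj₁ u) (inj₁ v) = if crossAB u v then false else adj G u v
  subdivAdj (inj₁ u) (inj₂ ((a , b) , _)) = (u == a) ∨ (u == b)
  subdivAdj (inj₂ ((a , b) , _)) (inj₁ u) = (u == a) ∨ (u == b)
  subdivAdj (inj₂ _) (inj₂ _) = false

  A' : VSet SVert
  A' (inj₁ v) = A v
  A' (inj₂ _) = false

  B' : VSet SVert
  B' (inj₁ v) = B v
  B' (inj₂ _) = false

  R : VSet SVert
  R (inj₁ _) = false
  R (inj₂ _) = true

  sbcAdj : Adj SVert
  sbcAdj = bipComp (bipComp subdivAdj A' R) B' R

record InducedMatching {W : Set} (adj' : Adj W) (C D : VSet W) (k : ℕ) : Set where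
  field
    left     : Fin k → W
    right    : Fin k → W
    leftInC  : ∀ i → C (left i) ≡ true
    rightInD : ∀ i → D (right i) ≡ true
    leftInj  : Injective _≡_ _≡_ left
    rightInj : Injective _≡_ _≡_ right
    edge     : ∀ i → adj' (left i) (right i) ≡ true
    induced  : ∀ i j → ¬ (i ≡ j) → adj' (left i) (right j) ≡ false

CutmimAtMost : {W : Set} → Adj W → VSet W → VSet W → ℕ → Set
CutmimAtMost adj' C D m = ∀ k → InducedMatching adj' C D k → k ≤ m

-- In G' a vertex x ∈ A ∪ B sees a subdivision vertex r_ab exactly when it is
-- not an end of ab, since exactly one of the two complements flips the pair
-- x r_ab of the subdivision.  As A ∩ B = ∅, a vertex r_ab therefore has exactly one
-- non-neighbour in A (namely a) and one in B (namely b).  In an induced matching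
-- with three edges c₀d₀, c₁d₁, c₂d₂, both c₀ and c₂ are non-neighbours of d₁,
-- so c₀ = c₂, which is impossible.
module Submission where

open import Defs hiding (sym)
open import Data.Nat using (ℕ; suc; _+_; _≤_; z≤n; s≤s)
open import Data.Fin using (Fin; zero; suc)
open import Data.Fin.Properties using (_≟_)
open import Data.Bool using (true; false; not; _∨_)
open import Data.Bool.Properties using (not-injective)
open import Data.Sum using (_⊎_; inj₁; inj₂)
open import Data.Product using (_×_; _,_; proj₁; proj₂)
open import Data.Empty using (⊥-elim)
open import Relation.Binary.PropositionalEquality using (_≡_; refl; sym; trans; cong)
open import Relation.Nullary using (yes; no; contradiction)
open import Relation.Nullary.Decidable using (⌊_⌋)

AtMostOneNonNeighbour : {W : Set} → Adj W → VSet W → VSet W → Set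
AtMostOneNonNeighbour {W} adj' C D = ∀ {c c′ d : W} →
  C c ≡ true → C c′ ≡ true → D d ≡ true →
  adj' c d ≡ false → adj' c′ d ≡ false → c ≡ c′

cutmim≤2-if-atMostOneNonNeighbour : {W : Set} {adj' : Adj W} {C D : VSet W} →
  AtMostOneNonNeighbour adj' C D → CutmimAtMost adj' C D 2
cutmim≤2-if-atMostOneNonNeighbour _ 0 _ = z≤n
cutmim≤2-if-atMostOneNonNeighbour _ 1 _ = s≤s z≤n
cutmim≤2-if-atMostOneNonNeighbour _ 2 _ = s≤s (s≤s z≤n)
cutmim≤2-if-atMostOneNonNeighbour unique (suc (suc (suc k))) M =
  contradiction (leftInj c₀≡c₂) λ ()
  where
  open InducedMatching M
  one two : Fin (3 + k)
  one = suc zero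
  two = suc (suc zero)
  c₀≡c₂ : left zero ≡ left two
  c₀≡c₂ = unique (leftInC zero) (leftInC two) (rightInD one)
                 (induced zero one λ ()) (induced two one λ ())

endpoint-if-incident : ∀ {n} (x a b : Fin n) → (⌊ x ≟ a ⌋ ∨ ⌊ x ≟ b ⌋) ≡ true → x ≡ a ⊎ x ≡ b
endpoint-if-incident x a b h with x ≟ a | x ≟ b
endpoint-if-incident x a b h  | yes x≡a | _       = inj₁ x≡a
endpoint-if-incident x a b h  | no _    | yes x≡b = inj₂ x≡b
endpoint-if-incident x a b () | no _    | no _

module _ {n : ℕ} (G : Graph n) (A B : VSet (Fin n)) (disjoint : Disjoint A B) where

  private
    G′ : Adj (SVert G A B)
    G′ = sbcAdj G A B

    B-false-if-A : ∀ {x} → A x ≡ true → B x ≡ false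
    B-false-if-A {x} Ax with B x in Bx
    ... | true  = ⊥-elim (disjoint x Ax Bx)
    ... | false = refl

    A-false-if-B : ∀ {x} → B x ≡ true → A x ≡ false
    A-false-if-B {x} Bx with A x in Ax
    ... | true  = ⊥-elim (disjoint x Ax Bx)
    ... | false = refl

    sbcAdj-A-new : ∀ {x} (e : SubEdge G A B) → A x ≡ true →
      G′ (inj₁ x) (inj₂ e) ≡ not (subdivAdj G A B (inj₁ x) (inj₂ e))
    sbcAdj-A-new e Ax rewrite Ax | B-false-if-A Ax = refl

    sbcAdj-B-new : ∀ {x} (e : SubEdge G A B) → B x ≡ true →
      G′ (inj₁ x) (inj₂ e) ≡ not (subdivAdj G A B (inj₁ x) (inj₂ e))
    sbcAdj-B-new e Bx rewrite Bx | A-false-if-B Bx = refl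

    A-nonNeighbour-is-tail : ∀ {x} (e : SubEdge G A B) → A x ≡ true →
      G′ (inj₁ x) (inj₂ e) ≡ false → x ≡ proj₁ (proj₁ e)
    A-nonNeighbour-is-tail {x} e@((a , b) , _ , Bb , _) Ax nonadj
      with endpoint-if-incident x a b (not-injective (trans (sym (sbcAdj-A-new e Ax)) nonadj))
    ... | inj₁ x≡a = x≡a
    ... | inj₂ x≡b = ⊥-elim (disjoint x Ax (trans (cong B x≡b) Bb))

    B-nonNeighbour-is-head : ∀ {x} (e : SubEdge G A B) → B x ≡ true →
      G′ (inj₁ x) (inj₂ e) ≡ false → x ≡ proj₂ (proj₁ e)
    B-nonNeighbour-is-head {x} e@((a , b) , Aa , _ , _) Bx nonadj
      with endpoint-if-incident x a b (not-injective (trans (sym (sbcAdj-B-new e Bx)) nonadj))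
    ... | inj₁ x≡a = ⊥-elim (disjoint x (trans (cong A x≡a) Aa) Bx)
    ... | inj₂ x≡b = x≡b

  atMostOneNonNeighbour-A-R : AtMostOneNonNeighbour G′ (A' G A B) (R G A B)
  atMostOneNonNeighbour-A-R {inj₁ x} {inj₁ x′} {inj₂ e} Ax Ax′ _ nonadj nonadj′ =
    cong inj₁ (trans (A-nonNeighbour-is-tail e Ax nonadj) (sym (A-nonNeighbour-is-tail e Ax′ nonadj′)))

  atMostOneNonNeighbour-B-R : AtMostOneNonNeighbour G′ (B' G A B) (R G A B)
  atMostOneNonNeighbour-B-R {inj₁ x} {inj₁ x′} {inj₂ e} Bx Bx′ _ nonadj nonadj′ =
    cong inj₁ (trans (B-nonNeighbour-is-head e Bx nonadj) (sym (B-nonNeighbour-is-head e Bx′ nonadj′)))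

lemma21 : ∀ {n : ℕ} (G : Graph n) (A B : VSet (Fin n)) → Disjoint A B →
    CutmimAtMost (sbcAdj G A B) (A' G A B) (R G A B) 2 ×
    CutmimAtMost (sbcAdj G A B) (B' G A B) (R G A B) 2
lemma21 G A B disjoint =
  cutmim≤2-if-atMostOneNonNeighbour (atMostOneNonNeighbour-A-R G A B disjoint) ,
  cutmim≤2-if-atMostOneNonNeighbour (atMostOneNonNeighbour-B-R G A B disjoint)
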